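{- Let $n$ be an even positive integer and $N=(2n+1)(4^{2n+1}+1)$. If $a_1,a_2,\ldots,a_N$ is any sequence of integers with $1\le a_i\le 4$ for all $1\le i\le N$, then there exist integers $1\le n_1<n_2$ with $n_2+2n\le N$, $n_1\equiv n_2\pmod 2$, and $a_{n_1+i}=a_{n_2+i}$ for all $0\le i\le 2n$. -}

module Defs where

open import Data.Nat using (ℕ; _+_; _*_; _^_)

bigN : ℕ → ℕ
bigN n = (2 * n + 1) * (4 ^ (2 * n + 1) + 1)

-- Encode each letter 1, …, 4 as an element of Fin 4, so that a window of
-- length 2n + 1 becomes a function Fin (2n + 1) → Fin 4, i.e. one of 4^(2n+1)
-- codes. The 4^(2n+1) + 1 windows starting at the odd positions 1, 3, 5, …
-- all fit inside a₁ … a_N, so by the pigeonhole principle two of them agree;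
-- their starting points are both odd.
module Submission where

open import Defs
open import Data.Nat using (ℕ; suc; pred; _+_; _*_; _^_; _≤_; _<_; _%_; z≤n; s≤s; s≤s⁻¹; z<s; NonZero; >-nonZero)
open import Data.Nat.Properties
open import Data.Nat.DivMod using (_mod_; m<n⇒m%n≡m; [m+kn]%n≡m%n)
open import Data.Nat.Divisibility using (_∣_)
open import Data.Nat.Solver using (module +-*-Solver)
open import Data.Fin using (Fin; toℕ; fromℕ<; funToFin; finToFun)
import Data.Fin as Fin
open import Data.Fin.Properties using (pigeonhole; toℕ-fromℕ<; fromℕ<-injective; toℕ<n; finToFun-funToFin)
open import Data.Product using (_×_; ∃₂; _,_)
open import Function using (_∘_)
open import Relation.Binary.PropositionalEquality

funToFin-injective : ∀ {m n} {f g : Fin m → Fin n} → funToFin f ≡ funToFin g → f ≗ g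
funToFin-injective {f = f} {g} eq k = begin
  f k                       ≡⟨ finToFun-funToFin f k ⟨
  finToFun (funToFin f) k   ≡⟨ cong (λ c → finToFun c k) eq ⟩
  finToFun (funToFin g) k   ≡⟨ finToFun-funToFin g k ⟩
  g k                       ∎
  where open ≡-Reasoning

repeated-window : ∀ {b} L (s : ℕ → Fin b) (p : Fin (suc (b ^ L)) → ℕ)
                → ∃₂ λ i j → i Fin.< j × (∀ k → k < L → s (p i + k) ≡ s (p j + k))
repeated-window L s p with pigeonhole (n<1+n _) (funToFin ∘ window)
  where
  window : Fin (suc _) → Fin L → Fin _
  window j k = s (p j + toℕ k)
... | i , j , i<j , sameCode = i , j , i<j , sameWindow
  where
  sameWindow : ∀ k → k < L → s (p i + k) ≡ s (p j + k)
  sameWindow k k<L = begin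
    s (p i + k)                        ≡⟨ cong (λ m → s (p i + m)) (toℕ-fromℕ< k<L) ⟨
    s (p i + toℕ (fromℕ< k<L))         ≡⟨ funToFin-injective sameCode (fromℕ< k<L) ⟩
    s (p j + toℕ (fromℕ< k<L))         ≡⟨ cong (λ m → s (p j + m)) (toℕ-fromℕ< k<L) ⟩
    s (p j + k)                        ∎
    where open ≡-Reasoning

letter : ∀ b .{{_ : NonZero b}} → ℕ → Fin b
letter b x = pred x mod b

letter-injective : ∀ {b} .{{_ : NonZero b}} {x y} → 1 ≤ x → x ≤ b → 1 ≤ y → y ≤ b
                 → letter b x ≡ letter b y → x ≡ y
letter-injective {b} {suc x} {suc y} _ x<b _ y<b eq = cong suc (begin
  x       ≡⟨ m<n⇒m%n≡m x<b ⟨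
  x % b   ≡⟨ fromℕ<-injective (x % b) (y % b) _ _ eq ⟩
  y % b   ≡⟨ m<n⇒m%n≡m y<b ⟩
  y       ∎)
  where open ≡-Reasoning

oddPosition : ∀ {K} → Fin K → ℕ
oddPosition j = 1 + toℕ j * 2

oddPosition-< : ∀ {K} {i j : Fin K} → i Fin.< j → oddPosition i < oddPosition j
oddPosition-< i<j = +-monoʳ-< 1 (*-monoˡ-< 2 i<j)

oddPosition-%2 : ∀ {K} (j : Fin K) → oddPosition j % 2 ≡ 1
oddPosition-%2 j = [m+kn]%n≡m%n 1 (toℕ j) 2

oddPosition-window-≤ : ∀ {K} t (j : Fin (suc K)) → 1 ≤ t → oddPosition j + t ≤ (t + 1) * (K + 1)
oddPosition-window-≤ {K} t j 1≤t = begin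
  1 + toℕ j * 2 + t     ≤⟨ +-monoˡ-≤ t (+-monoʳ-≤ 1 (*-monoˡ-≤ 2 (s≤s⁻¹ (toℕ<n j)))) ⟩
  1 + K * 2 + t         ≡⟨ solve 2 (λ t K → con 1 :+ K :* con 2 :+ t := con 1 :+ (K :+ K) :+ t) refl t K ⟩
  1 + (K + K) + t       ≤⟨ +-monoˡ-≤ t (+-monoʳ-≤ 1 (+-monoʳ-≤ K (m≤n*m K t {{>-nonZero 1≤t}}))) ⟩
  1 + (K + t * K) + t   ≡⟨ solve 2 (λ t K → con 1 :+ (K :+ t :* K) :+ t := (t :+ con 1) :* (K :+ con 1)) refl t K ⟩
  (t + 1) * (K + 1)     ∎
  where
  open ≤-Reasoning
  open +-*-Solver

lemma8 : (n : ℕ) → 2 ∣ n → 1 ≤ n → (a : ℕ → ℕ)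
    → (∀ i → 1 ≤ i → i ≤ bigN n → 1 ≤ a i × a i ≤ 4)
    → ∃₂ λ n₁ n₂ → 1 ≤ n₁ × n₁ < n₂ × n₂ + 2 * n ≤ bigN n
    × n₁ % 2 ≡ n₂ % 2
    × (∀ i → i ≤ 2 * n → a (n₁ + i) ≡ a (n₂ + i))
lemma8 n _ 1≤n a a∈[1,4] with repeated-window (2 * n + 1) (letter 4 ∘ a) oddPosition
... | i , j , i<j , sameLetters =
  oddPosition i , oddPosition j , s≤s z≤n , oddPosition-< i<j , fits j ,
  trans (oddPosition-%2 i) (sym (oddPosition-%2 j)) , sameValues
  where
  fits : ∀ m → oddPosition m + 2 * n ≤ bigN n
  fits m = oddPosition-window-≤ (2 * n) m (≤-trans 1≤n (m≤n*m n 2))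

  valueBounds : ∀ m k → k ≤ 2 * n → 1 ≤ a (oddPosition m + k) × a (oddPosition m + k) ≤ 4
  valueBounds m k k≤2n = a∈[1,4] _ (s≤s z≤n) (≤-trans (+-monoʳ-≤ (oddPosition m) k≤2n) (fits m))

  sameValues : ∀ k → k ≤ 2 * n → a (oddPosition i + k) ≡ a (oddPosition j + k)
  sameValues k k≤2n with valueBounds i k k≤2n | valueBounds j k k≤2n
  ... | 1≤aᵢ , aᵢ≤4 | 1≤aⱼ , aⱼ≤4 =
    letter-injective 1≤aᵢ aᵢ≤4 1≤aⱼ aⱼ≤4 (sameLetters k (≤-<-trans k≤2n (m<m+n (2 * n) z<s)))
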